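{- Let $S,T$ be nonempty subsets of $[n-1]$ such that $A=T_n\langle S;T\rangle$ is a walk-ensured Toeplitz matrix, let $d=\gcd(S\cup T)$, and let $B$ be an $n\times n$ Boolean matrix with $A\le B$ (entrywise). If the digraph $D(B-A)/\mathbb{Z}_d$ has a source or a sink, then $A$ and $B$ have the same matrix period.
   Context: Matrices are Boolean ($0,1$ entries with $1+1=1$), and powers are Boolean matrix powers. For nonempty $S,T\subseteq[n-1]$, $T_n\langle S;T\rangle$ denotes the $n\times n$ $(0,1)$-matrix whose $(i,j)$-entry is $1$ if and only if $j-i\in S$ or $i-j\in T$. For an $n\times n$ Boolean matrix $C$, its digraph $D(C)$ has vertex set $[n]$ and an arc $(i,j)$ exactly when the $(i,j)$-entry of $C$ is $1$. For $A\le B$, $B-A$ is the $(0,1)$-matrix having $1$ exactly in the positions where $B$ has $1$ and $A$ has $0$. $\gcd(S\cup T)$ is the gcd of all elements of $S\cup T$; $\gcd(S+T)=\gcd\{s+t: s\in S,t\in T\}$; $s_1=\min S$. The matrix $A$ is called walk-ensured if there is a positive integer $M$ such that for all vertices $u,v\in[n]$ and every integer $\ell\ge M$ with $v-u\equiv \ell s_1 \pmod{\gcd(S+T)}$, there is a directed walk from $u$ to $v$ of length $\ell$ in $D(A)$. The matrix period of a Boolean square matrix $A$ is the smallest positive integer $p$ for which there is $M$ with $A^m=A^{m+p}$ for all $m\ge M$. For a digraph $D$ on $[n]$ and a positive integer $d$, $D/\mathbb{Z}_d$ is the digraph on $\{1,\ldots,d\}$ (obtained by contracting each residue class mod $d$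 to its representative in $\{1,\ldots,d\}$) with an arc $(i,j)$ (loops allowed) if and only if $D$ has an arc $(m,l)$ with $m\equiv i$ and $l\equiv j \pmod d$. A source is a vertex with no incoming arcs and a sink is a vertex with no outgoing arcs. -}

module Defs where

open import Data.Nat using (ℕ; zero; suc; _+_; _*_; _∸_; _≤_; _<_; _≥_; _⊓_; _≡ᵇ_)
open import Data.Nat.GCD using (gcd)
open import Data.Bool using (Bool; true; false; _∧_; _∨_; not; if_then_else_)
open import Data.Fin using (Fin; toℕ; _≟_)
open import Data.List using (List; []; _∷_; foldr; map; concatMap; allFin; _++_)
open import Data.Bool.ListAction using (any; or)
open import Data.Sum using (_⊎_)
open import Data.List.Relation.Unary.All using (All)
open import Data.Product using (Σ; ∃; _×_; _,_)
open import Data.Integer as ℤ using (ℤ; +_)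
open import Data.Integer.Divisibility as ℤD using ()
open import Relation.Binary.PropositionalEquality using (_≡_; _≢_)
open import Relation.Nullary using (¬_; does)

-- n × n Boolean matrices; index k : Fin n stands for vertex k+1 ∈ [n]
Mat : ℕ → Set
Mat n = Fin n → Fin n → Bool

_∈ᵇ_ : ℕ → List ℕ → Bool
x ∈ᵇ xs = any (λ s → s ≡ᵇ x) xs

-- T_n⟨S;T⟩ : entry (i,j) is 1 iff j - i ∈ S or i - j ∈ T
-- (differences are genuine integer differences: j - i ∈ S requires j > i
--  since S ⊆ [n-1] contains no 0 and no truncation occurs when j > i)
toeplitz : (n : ℕ) → List ℕ → List ℕ → Mat n
toeplitz n S T i j =
  (if does (toℕ i Data.Nat.<? toℕ j) then (toℕ j ∸ toℕ i) ∈ᵇ S else false)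
  ∨ (if does (toℕ j Data.Nat.<? toℕ i) then (toℕ i ∸ toℕ j) ∈ᵇ T else false)

NonemptySubsetOf : ℕ → List ℕ → Set
NonemptySubsetOf n S = (S ≢ []) × All (λ s → 1 ≤ s × s ≤ n ∸ 1) S

-- gcd of a finite list of naturals (gcd of the empty list is 0)
gcdList : List ℕ → ℕ
gcdList = foldr gcd 0

gcdUnion : List ℕ → List ℕ → ℕ
gcdUnion S T = gcdList (S ++ T)

gcdSum : List ℕ → List ℕ → ℕ
gcdSum S T = gcdList (concatMap (λ s → map (λ t → s + t) T) S)

-- minimum of a list (only used for nonempty lists)
listMin : List ℕ → ℕ
listMin []       = 0
listMin (x ∷ xs) = foldr _⊓_ x xs

Walk : {n : ℕ} → Mat n → ℕ → Fin n → Fin n → Set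
Walk C zero    u v = u ≡ v
Walk C (suc ℓ) u v = Σ _ λ w → (C u w ≡ true) × Walk C ℓ w v

WalkEnsured : (n : ℕ) → List ℕ → List ℕ → Set
WalkEnsured n S T =
  Σ ℕ λ M → 1 ≤ M ×
    ((u v : Fin n) (ℓ : ℕ) → ℓ ≥ M →
      (+ gcdSum S T) ℤD.∣ ((+ toℕ v ℤ.- + toℕ u) ℤ.- + (ℓ * listMin S)) →
      Walk (toeplitz n S T) ℓ u v)

_⊗_ : {n : ℕ} → Mat n → Mat n → Mat n
(A ⊗ B) i j = or (map (λ k → A i k ∧ B k j) (allFin _))

idMat : {n : ℕ} → Mat n
idMat i j = does (i ≟ j)

_^_ : {n : ℕ} → Mat n → ℕ → Mat n
A ^ zero  = idMat
A ^ suc m = (A ^ m) ⊗ A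

_≤ₘ_ : {n : ℕ} → Mat n → Mat n → Set
A ≤ₘ B = ∀ i j → A i j ≡ true → B i j ≡ true

_−ₘ_ : {n : ℕ} → Mat n → Mat n → Mat n
(B −ₘ A) i j = B i j ∧ not (A i j)

IsEventualPeriod : {n : ℕ} → Mat n → ℕ → Set
IsEventualPeriod A p = 1 ≤ p × Σ ℕ λ M → ∀ m → m ≥ M → ∀ i j → (A ^ m) i j ≡ (A ^ (m + p)) i j

MatrixPeriod : {n : ℕ} → Mat n → ℕ → Set
MatrixPeriod A p = IsEventualPeriod A p × (∀ q → IsEventualPeriod A q → p ≤ q)

_≡_[mod_] : ℕ → ℕ → ℕ → Set
x ≡ a [mod d ] = Σ ℕ λ q → x ≡ a + q * d

-- D(C)/ℤ_d : vertices a < d (0-based representatives; a stands for a+1 ∈ {1,…,d});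
-- arc (a,b) iff some arc (m,l) of D(C) with m ≡ a, l ≡ b (mod d)
QArc : {n : ℕ} → Mat n → ℕ → ℕ → ℕ → Set
QArc C d a b = Σ _ λ m → Σ _ λ l → (C m l ≡ true) × (toℕ m ≡ a [mod d ]) × (toℕ l ≡ b [mod d ])

HasSourceOrSink : {n : ℕ} → Mat n → ℕ → Set
HasSourceOrSink C d =
  Σ ℕ λ a → a < d ×
    ((∀ b → b < d → ¬ QArc C d b a) ⊎ (∀ b → b < d → ¬ QArc C d a b))

{-# OPTIONS --safe #-}
-- Let g = gcd(S + T), s₁ = min S and p the additive order of s₁ modulo g.  Every arc of
-- A = T_n⟨S;T⟩ moves the vertex by s₁ modulo g, so closed walks of A have lengths ℓ with
-- g ∣ ℓ·s₁, while walk-ensuredness supplies closed walks of every length j·p (j large) at every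
-- vertex.  Such closed walks make p an eventual period of any matrix containing them: a long
-- walk is shortened below n·p by cutting out closed subwalks of length divisible by p
-- (pigeonhole) and lengthened again by inserting one.  Conversely an eventual period q turns a
-- long closed walk at a vertex u into one that is q steps longer, so g ∣ q·s₁ and p ≤ q as soon
-- as all closed walks at u obey the congruence.  This also holds in B when u lies in the source
-- or sink class of D(B − A)/ℤ_d: arcs of A preserve residues mod d, so a closed walk of B at u
-- never uses an arc of B − A.
module Submission where

open import Defs
open import Data.Bool using (Bool; true; false; _∧_; not)
open import Data.Bool.Properties using (T-≡; T-∧; ∨-identityʳ; ⇔→≡)
open import Data.Empty using (⊥-elim)
open import Data.Fin using (Fin; toℕ; fromℕ<; _≟_)
open import Data.Fin.Properties using (pigeonhole; toℕ≤pred[n]; toℕ-fromℕ<)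
import Data.Integer as ℤ
import Data.Integer.Properties as ℤ
import Data.Integer.Divisibility.Signed as ℤ∣
open import Data.Integer.Tactic.RingSolver using (solve-∀)
open import Data.List using (List; []; _∷_; map; allFin)
open import Data.List.Membership.Propositional using (_∈_; lose)
open import Data.List.Membership.Propositional.Properties
  using (∈-allFin; ∈-map⁺; ∈-concat⁺′; ∈-++⁺ˡ; ∈-++⁺ʳ; foldr-selective)
open import Data.List.Relation.Unary.All using (lookup)
open import Data.List.Relation.Unary.Any as Any using (here; there)
open import Data.List.Relation.Unary.Any.Properties using (any⁺; any⁻)
open import Data.Nat hiding (_^_; _≟_)
open import Data.Nat.DivMod using (_%_; _/_; m≡m%n+[m/n]*n; [m+kn]%n≡m%n; m<n⇒m%n≡m; m%n<n)
open import Data.Nat.Divisibility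
  using (_∣_; divides; _∣0; _∣?_; ∣-trans; m∣m*n; n∣m*n; ∣m+n∣m⇒∣n; ∣⇒≤)
open import Data.Nat.GCD using (gcd[m,n]∣m; gcd[m,n]∣n)
open import Data.Nat.Induction using (<-rec)
open import Data.Nat.Properties hiding (_≟_)
open import Data.Product using (Σ; ∃; ∃₂; _×_; _,_; proj₁; proj₂)
open import Data.Sum using (_⊎_; inj₁; inj₂; [_,_]′)
open import Function using (_∘_; Equivalence; mk⇔)
open import Relation.Nullary using (¬_; yes; no)
open import Relation.Nullary.Decidable using (dec-true; _×-dec_)
open import Relation.Binary.PropositionalEquality
open import Relation.Unary using (Decidable)

open Equivalence using (to; from)

module _ {n : ℕ} {C : Mat n} where

  Walk-++ : ∀ {a b x y z} → Walk C a x y → Walk C b y z → Walk C (a + b) x z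
  Walk-++ {zero}  refl        w′ = w′
  Walk-++ {suc a} (_ , e , w) w′ = _ , e , Walk-++ w w′

  Walk-snoc : ∀ {m x y z} → Walk C m x y → C y z ≡ true → Walk C (suc m) x z
  Walk-snoc {zero}  refl        e′ = _ , e′ , refl
  Walk-snoc {suc m} (_ , e , w) e′ = _ , e , Walk-snoc w e′

  Walk-unsnoc : ∀ {m x z} → Walk C (suc m) x z → ∃ λ y → Walk C m x y × C y z ≡ true
  Walk-unsnoc {zero}  (_ , e , refl) = _ , refl , e
  Walk-unsnoc {suc m} (_ , e , w)    =
    let y , w′ , e′ = Walk-unsnoc w in y , (_ , e , w′) , e′

  Walk-splitAt : ∀ {ℓ x z} k → k ≤ ℓ → Walk C ℓ x z →
                 ∃ λ y → Walk C k x y × Walk C (ℓ ∸ k) y z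
  Walk-splitAt zero    _         w           = _ , refl , w
  Walk-splitAt (suc k) (s≤s k≤ℓ) (_ , e , w) =
    let y , w₁ , w₂ = Walk-splitAt k k≤ℓ w in y , (_ , e , w₁) , w₂

Walk-mono : ∀ {n} {A B : Mat n} → A ≤ₘ B → ∀ {ℓ x y} → Walk A ℓ x y → Walk B ℓ x y
Walk-mono A≤B {zero}  w           = w
Walk-mono A≤B {suc ℓ} (z , e , w) = z , A≤B _ _ e , Walk-mono A≤B w

module _ {n : ℕ} {A B : Mat n} {i j : Fin n} where

  ⊗-true⁻ : (A ⊗ B) i j ≡ true → ∃ λ k → A i k ≡ true × B k j ≡ true
  ⊗-true⁻ h =
    let k , Tk = Any.satisfied (any⁻ (λ k → A i k ∧ B k j) (allFin n) (from T-≡ h))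
        TA , TB = to T-∧ Tk
    in k , to T-≡ TA , to T-≡ TB

  ⊗-true⁺ : ∀ k → A i k ≡ true → B k j ≡ true → (A ⊗ B) i j ≡ true
  ⊗-true⁺ k a b = to T-≡ (any⁺ _ (lose (∈-allFin k) (from T-∧ (from T-≡ a , from T-≡ b))))

module _ {n : ℕ} (C : Mat n) where

  ^⇒Walk : ∀ m {i j} → (C ^ m) i j ≡ true → Walk C m i j
  ^⇒Walk zero {i} {j} h with i ≟ j
  ... | yes i≡j = i≡j
  ^⇒Walk zero {i} {j} () | no _
  ^⇒Walk (suc m) h =
    let k , c , e = ⊗-true⁻ {A = C ^ m} {B = C} h in Walk-snoc (^⇒Walk m c) e

  Walk⇒^ : ∀ m {i j} → Walk C m i j → (C ^ m) i j ≡ true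
  Walk⇒^ zero    {i} refl = dec-true (i ≟ i) refl
  Walk⇒^ (suc m) w        =
    let k , w′ , e = Walk-unsnoc w in ⊗-true⁺ {A = C ^ m} {B = C} k (Walk⇒^ m w′) e

module _ {n : ℕ} {C : Mat n} {p : ℕ} (p≥1 : 1 ≤ p) where

  ShortWalk : ℕ → Fin n → Fin n → Set
  ShortWalk ℓ x y = ∃₂ λ k ℓ′ → ℓ′ < n * p × ℓ ≡ k * p + ℓ′ × Walk C ℓ′ x y

  -- Among the n + 1 vertices visited at times 0, p, …, n·p two coincide.
  Walk-removeCycle : ∀ {ℓ x y} → n * p ≤ ℓ → Walk C ℓ x y →
                     ∃₂ λ c ℓ₁ → 1 ≤ c × ℓ ≡ c * p + ℓ₁ × Walk C ℓ₁ x y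
  Walk-removeCycle {ℓ} {x} {y} np≤ℓ w = cut (pigeonhole (n<1+n n) (proj₁ ∘ split))
    where
    ip≤ℓ : (i : Fin (suc n)) → toℕ i * p ≤ ℓ
    ip≤ℓ i = ≤-trans (*-monoˡ-≤ p (toℕ≤pred[n] i)) np≤ℓ

    split : (i : Fin (suc n)) → ∃ λ z → Walk C (toℕ i * p) x z × Walk C (ℓ ∸ toℕ i * p) z y
    split i = Walk-splitAt (toℕ i * p) (ip≤ℓ i) w

    cut : (∃₂ λ i j → toℕ i < toℕ j × proj₁ (split i) ≡ proj₁ (split j)) →
          ∃₂ λ c ℓ₁ → 1 ≤ c × ℓ ≡ c * p + ℓ₁ × Walk C ℓ₁ x y
    cut (i , j , i<j , same) =
      c , a * p + r , m<n⇒0<n∸m i<j , ℓ≡ ,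
      Walk-++ (proj₁ (proj₂ (split i)))
              (subst (λ z → Walk C r z y) (sym same) (proj₂ (proj₂ (split j))))
      where
      open ≡-Reasoning
      a b c r : ℕ
      a = toℕ i
      b = toℕ j
      c = b ∸ a
      r = ℓ ∸ b * p
      ℓ≡ : ℓ ≡ c * p + (a * p + r)
      ℓ≡ = begin
        ℓ                   ≡⟨ m+[n∸m]≡n (ip≤ℓ j) ⟨
        b * p + r           ≡⟨ cong (λ k → k * p + r) (m∸n+n≡m (<⇒≤ i<j)) ⟨
        (c + a) * p + r     ≡⟨ cong (_+ r) (*-distribʳ-+ p c a) ⟩
        c * p + a * p + r   ≡⟨ +-assoc (c * p) (a * p) r ⟩
        c * p + (a * p + r) ∎

  shorten : ∀ ℓ {x y} → Walk C ℓ x y → ShortWalk ℓ x y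
  shorten = <-rec (λ ℓ → ∀ {x y} → Walk C ℓ x y → ShortWalk ℓ x y) step
    where
    step : ∀ ℓ → (∀ {ℓ₁} → ℓ₁ < ℓ → ∀ {x y} → Walk C ℓ₁ x y → ShortWalk ℓ₁ x y) →
           ∀ {x y} → Walk C ℓ x y → ShortWalk ℓ x y
    step ℓ rec w with ℓ <? n * p
    ... | yes ℓ<np = 0 , ℓ , ℓ<np , refl , w
    ... | no ℓ≮np with Walk-removeCycle (≮⇒≥ ℓ≮np) w
    ... | c , ℓ₁ , c≥1 , ℓ≡ , w₁ with rec (subst (ℓ₁ <_) (sym ℓ≡) (m<n+m ℓ₁ (*-mono-≤ c≥1 p≥1))) w₁
    ... | k , ℓ′ , ℓ′<np , ℓ₁≡ , w′ = c + k , ℓ′ , ℓ′<np , ℓ≡′ , w′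
      where
      open ≡-Reasoning
      ℓ≡′ : ℓ ≡ (c + k) * p + ℓ′
      ℓ≡′ = begin
        ℓ                    ≡⟨ ℓ≡ ⟩
        c * p + ℓ₁           ≡⟨ cong (c * p +_) ℓ₁≡ ⟩
        c * p + (k * p + ℓ′) ≡⟨ +-assoc (c * p) (k * p) ℓ′ ⟨
        c * p + k * p + ℓ′   ≡⟨ cong (_+ ℓ′) (*-distribʳ-+ p c k) ⟨
        (c + k) * p + ℓ′     ∎

  ShortWalk-rounds : ∀ {J ℓ k ℓ′} → J * p + n * p ≤ ℓ → ℓ′ < n * p → ℓ ≡ k * p + ℓ′ → J < k
  ShortWalk-rounds {J} {k = k} ℓ≥ ℓ′<np ℓ≡ =
    *-cancelʳ-< p J k (+-cancelʳ-< (n * p) (J * p) (k * p)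
      (≤-<-trans (subst (J * p + n * p ≤_) ℓ≡ ℓ≥) (+-monoʳ-< (k * p) ℓ′<np)))

  loops⇒IsEventualPeriod : (J : ℕ) → (∀ w j → J ≤ j → Walk C (j * p) w w) → IsEventualPeriod C p
  loops⇒IsEventualPeriod J loops = p≥1 , J * p + n * p , periodic
    where
    one-more-round : ∀ k ℓ′ → suc k * p + ℓ′ ≡ k * p + ℓ′ + p
    one-more-round k ℓ′ = trans (+-assoc p (k * p) ℓ′) (+-comm p (k * p + ℓ′))

    prependLoop : ∀ {k ℓ′ x y} → J ≤ k → Walk C ℓ′ x y → Walk C (k * p + ℓ′) x y
    prependLoop {x = x} J≤k = Walk-++ (loops x _ J≤k)

    lengthen : ∀ {m x y} → J * p + n * p ≤ m → Walk C m x y → Walk C (m + p) x y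
    lengthen {m} {x} {y} m≥ w with shorten m w
    ... | k , ℓ′ , ℓ′<np , m≡ , w′ =
      subst (λ l → Walk C l x y) (trans (one-more-round k ℓ′) (cong (_+ p) (sym m≡)))
        (prependLoop (<⇒≤ (m<n⇒m<1+n (ShortWalk-rounds {J = J} {k = k} m≥ ℓ′<np m≡))) w′)

    unlengthen : ∀ {m x y} → J * p + n * p ≤ m → Walk C (m + p) x y → Walk C m x y
    unlengthen {m} {x} {y} m≥ w with shorten (m + p) w
    ... | k , ℓ′ , ℓ′<np , m+p≡ , w′
        with ShortWalk-rounds {J = J} {k = k} (≤-trans m≥ (m≤m+n m p)) ℓ′<np m+p≡
    ... | s≤s {n = k′} J≤k′ = subst (λ l → Walk C l x y) m≡ (prependLoop J≤k′ w′)
      where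
      m≡ : k′ * p + ℓ′ ≡ m
      m≡ = sym (+-cancelʳ-≡ p m (k′ * p + ℓ′) (trans m+p≡ (one-more-round k′ ℓ′)))

    periodic : ∀ m → m ≥ J * p + n * p → ∀ i j → (C ^ m) i j ≡ (C ^ (m + p)) i j
    periodic m m≥ i j = ⇔→≡ (mk⇔ (Walk⇒^ C (m + p) ∘ lengthen m≥ ∘ ^⇒Walk C m)
                                 (Walk⇒^ C m ∘ unlengthen m≥ ∘ ^⇒Walk C (m + p)))

IsEventualPeriod⇒∣ : ∀ {n} {C : Mat n} {u : Fin n} {g s q : ℕ} → IsEventualPeriod C q →
                     (∀ {ℓ} → Walk C ℓ u u → g ∣ ℓ * s) →
                     (∀ M → ∃ λ m → M ≤ m × Walk C m u u) →
                     g ∣ q * s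
IsEventualPeriod⇒∣ {C = C} {u} {g} {s} {q} (_ , M , periodic) closed unbounded
  with unbounded M
... | m , M≤m , loop =
  ∣m+n∣m⇒∣n (subst (g ∣_) (*-distribʳ-+ s m q) (closed loop′)) (closed loop)
  where
  loop′ : Walk C (m + q) u u
  loop′ = ^⇒Walk C (m + q) (trans (sym (periodic m M≤m u u)) (Walk⇒^ C m loop))

IsLeast : (ℕ → Set) → ℕ → Set
IsLeast P p = P p × (∀ q → P q → p ≤ q)

least : ∀ {P : ℕ → Set} → Decidable P → ∀ {k} → P k → ∃ (IsLeast P)
least {P} P? {k} Pk = search 0 k (λ _ ()) Pk
  where
  search : ∀ i r → (∀ j → j < i → ¬ P j) → P (i + r) → ∃ (IsLeast P)
  search i r none-below Pi+r with P? i
  ... | yes Pi = i , Pi , λ q Pq → ≮⇒≥ λ q<i → none-below q q<i Pq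
  search i zero    none-below Pi+0 | no ¬Pi = ⊥-elim (¬Pi (subst P (+-identityʳ i) Pi+0))
  search i (suc r) none-below Pi+r | no ¬Pi =
    search (suc i) r none-below′ (subst P (+-suc i r) Pi+r)
    where
    none-below′ : ∀ j → j < suc i → ¬ P j
    none-below′ j j<1+i = [ none-below j , (λ { refl → ¬Pi }) ]′ (m<1+n⇒m<n∨m≡n j<1+i)

Annihilates : ℕ → ℕ → ℕ → Set
Annihilates g s q = 1 ≤ q × g ∣ q * s

additiveOrder : ∀ {g c} s → 1 ≤ c → g ∣ c → ∃ (IsLeast (Annihilates g s))
additiveOrder {g} s c≥1 g∣c =
  least (λ q → 1 ≤? q ×-dec g ∣? q * s) (c≥1 , ∣-trans g∣c (m∣m*n s))

loops⇒MatrixPeriod : ∀ {n} {C : Mat n} {g s p J : ℕ} (u : Fin n) →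
                     IsLeast (Annihilates g s) p →
                     (∀ w j → J ≤ j → Walk C (j * p) w w) →
                     (∀ {ℓ} → Walk C ℓ u u → g ∣ ℓ * s) →
                     MatrixPeriod C p
loops⇒MatrixPeriod {C = C} {p = p} {J} u ((p≥1 , _) , p-least) loops closed =
  loops⇒IsEventualPeriod p≥1 J loops ,
  λ q q-period → p-least q (proj₁ q-period , IsEventualPeriod⇒∣ q-period closed unbounded)
  where
  unbounded : ∀ M → ∃ λ m → M ≤ m × Walk C m u u
  unbounded M = (M + J) * p ,
                ≤-trans (m≤m+n M J) (m≤m*n (M + J) p {{>-nonZero p≥1}}) ,
                loops u (M + J) (m≤n+m J M)

module _ {n d : ℕ} .{{_ : NonZero d}} {A : Mat n}
         (arc-keepsResidue : ∀ {i j} → A i j ≡ true → toℕ i % d ≡ toℕ j % d) where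

  Walk-keepsResidue : ∀ {ℓ x y} → Walk A ℓ x y → toℕ x % d ≡ toℕ y % d
  Walk-keepsResidue {zero}  refl        = refl
  Walk-keepsResidue {suc ℓ} (_ , e , w) = trans (arc-keepsResidue e) (Walk-keepsResidue w)

  module _ {B : Mat n} {a : ℕ} where

    private
      ∧-not-true : ∀ {b c : Bool} → b ≡ true → c ≡ false → b ∧ not c ≡ true
      ∧-not-true refl refl = refl

      newArc : ∀ {i j} → B i j ≡ true → A i j ≡ false → QArc (B −ₘ A) d (toℕ i % d) (toℕ j % d)
      newArc {i} {j} inB notInA =
        i , j , ∧-not-true inB notInA ,
        (toℕ i / d , m≡m%n+[m/n]*n (toℕ i) d) , (toℕ j / d , m≡m%n+[m/n]*n (toℕ j) d)

    Walk-intoSource : (∀ b → b < d → ¬ QArc (B −ₘ A) d b a) →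
                      ∀ {ℓ x y} → Walk B ℓ x y → toℕ y % d ≡ a → Walk A ℓ x y
    Walk-intoSource _     {zero}       refl        _   = refl
    Walk-intoSource no-in {suc _} {x} (z , e , w) y≡a
      with Walk-intoSource no-in w y≡a | A x z in arc
    ... | w′ | true  = z , arc , w′
    ... | w′ | false = ⊥-elim (no-in (toℕ x % d) (m%n<n (toℕ x) d)
                         (subst (QArc (B −ₘ A) d (toℕ x % d)) (trans (Walk-keepsResidue w′) y≡a)
                                (newArc e arc)))

    Walk-fromSink : (∀ b → b < d → ¬ QArc (B −ₘ A) d a b) →
                    ∀ {ℓ x y} → Walk B ℓ x y → toℕ x % d ≡ a → Walk A ℓ x y
    Walk-fromSink _      {zero}       refl        _   = refl
    Walk-fromSink no-out {suc _} {x} (z , e , w) x≡a with A x z in arc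
    ... | true  = z , arc , Walk-fromSink no-out w (trans (sym (arc-keepsResidue arc)) x≡a)
    ... | false = ⊥-elim (no-out (toℕ z % d) (m%n<n (toℕ z) d)
                    (subst (λ c → QArc (B −ₘ A) d c (toℕ z % d)) x≡a (newArc e arc)))

    closedWalk-sourceOrSink : (∀ b → b < d → ¬ QArc (B −ₘ A) d b a) ⊎
                              (∀ b → b < d → ¬ QArc (B −ₘ A) d a b) →
                              ∀ {ℓ u} → toℕ u % d ≡ a → Walk B ℓ u u → Walk A ℓ u u
    closedWalk-sourceOrSink sourceOrSink u≡a w =
      [ (λ source → Walk-intoSource source w u≡a) , (λ sink → Walk-fromSink sink w u≡a) ]′
        sourceOrSink

∈ᵇ⇒∈ : ∀ {x xs} → x ∈ᵇ xs ≡ true → x ∈ xs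
∈ᵇ⇒∈ {x} {xs} h = Any.map (λ {y} y≡ᵇx → sym (≡ᵇ⇒≡ y x y≡ᵇx)) (any⁻ (_≡ᵇ x) xs (from T-≡ h))

<ᵇ≡true⇒< : ∀ m n → (m <ᵇ n) ≡ true → m < n
<ᵇ≡true⇒< m n h = <ᵇ⇒< m n (from T-≡ h)

<ᵇ≡true⇒≡+∸ : ∀ m n → (m <ᵇ n) ≡ true → n ≡ m + (n ∸ m)
<ᵇ≡true⇒≡+∸ m n h = sym (m+[n∸m]≡n (<⇒≤ (<ᵇ≡true⇒< m n h)))

gcdList-∣ : ∀ {x xs} → x ∈ xs → gcdList xs ∣ x
gcdList-∣ {xs = y ∷ ys} (here refl)  = gcd[m,n]∣m y (gcdList ys)
gcdList-∣ {xs = y ∷ ys} (there x∈ys) = ∣-trans (gcd[m,n]∣n y (gcdList ys)) (gcdList-∣ x∈ys)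

listMin∈ : ∀ {xs} → xs ≢ [] → listMin xs ∈ xs
listMin∈ {[]}     []≢[] = ⊥-elim ([]≢[] refl)
listMin∈ {x ∷ xs} _     = [ here , there ]′ (foldr-selective ⊓-sel x xs)

private
  arc-identityˢ : ∀ i s s₀ t₀ → (i ℤ.+ s ℤ.- i) ℤ.- s₀ ≡ (s ℤ.+ t₀) ℤ.- (s₀ ℤ.+ t₀)
  arc-identityˢ = solve-∀

  arc-identityᵗ : ∀ j t s₀ → (j ℤ.- (j ℤ.+ t)) ℤ.- s₀ ≡ ℤ.- (s₀ ℤ.+ t)
  arc-identityᵗ = solve-∀

  walk-identity : ∀ u w v a b → (w ℤ.- u ℤ.- a) ℤ.+ (v ℤ.- w ℤ.- b) ≡ v ℤ.- u ℤ.- (a ℤ.+ b)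
  walk-identity = solve-∀

  loop-identity : ∀ u x → u ℤ.- u ℤ.- x ≡ ℤ.- x
  loop-identity = solve-∀

  ∣[u-u]-x∣≡x : ∀ u x → ℤ.∣ (ℤ.+ u ℤ.- ℤ.+ u) ℤ.- ℤ.+ x ∣ ≡ x
  ∣[u-u]-x∣≡x u x = trans (cong ℤ.∣_∣ (loop-identity (ℤ.+ u) (ℤ.+ x))) (ℤ.∣-i∣≡∣i∣ (ℤ.+ x))

module ToeplitzWalks {n : ℕ} (S T : List ℕ) where

  A : Mat n
  A = toeplitz n S T

  g d : ℕ
  g = gcdSum S T
  d = gcdUnion S T

  arc⇒step : ∀ {i j} → A i j ≡ true →
             (∃ λ s → s ∈ S × toℕ j ≡ toℕ i + s) ⊎ (∃ λ t → t ∈ T × toℕ i ≡ toℕ j + t)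
  arc⇒step {i} {j} h with toℕ i <ᵇ toℕ j in i<j | toℕ j <ᵇ toℕ i in j<i
  ... | true  | true  = ⊥-elim (<-asym (<ᵇ≡true⇒< (toℕ i) (toℕ j) i<j) (<ᵇ≡true⇒< (toℕ j) (toℕ i) j<i))
  ... | true  | false = inj₁ (_ , ∈ᵇ⇒∈ (trans (sym (∨-identityʳ _)) h) , <ᵇ≡true⇒≡+∸ (toℕ i) (toℕ j) i<j)
  ... | false | true  = inj₂ (_ , ∈ᵇ⇒∈ h , <ᵇ≡true⇒≡+∸ (toℕ j) (toℕ i) j<i)
  arc⇒step {i} {j} () | false | false

  g∣s+t : ∀ {s t} → s ∈ S → t ∈ T → g ∣ s + t
  g∣s+t {s} s∈S t∈T =
    gcdList-∣ (∈-concat⁺′ (∈-map⁺ (s +_) t∈T) (∈-map⁺ (λ s → map (s +_) T) s∈S))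

  minS-order : NonemptySubsetOf n S → T ≢ [] → ∃ (IsLeast (Annihilates g (listMin S)))
  minS-order (S≢[] , S⊆[n-1]) T≢[] =
    additiveOrder (listMin S) (≤-trans (proj₁ (lookup S⊆[n-1] s∈S)) (m≤m+n _ _))
                  (g∣s+t s∈S (listMin∈ T≢[]))
    where
    s∈S : listMin S ∈ S
    s∈S = listMin∈ S≢[]

  module _ {s₀ t₀ : ℕ} (s₀∈S : s₀ ∈ S) (t₀∈T : t₀ ∈ T) where

    private
      ∣⇒ℤ∣ : ∀ {x} → g ∣ x → ℤ.+ g ℤ∣.∣ ℤ.+ x
      ∣⇒ℤ∣ = ℤ∣.∣ᵤ⇒∣

    arc-congruence : ∀ {i j} → A i j ≡ true → ℤ.+ g ℤ∣.∣ (ℤ.+ toℕ j ℤ.- ℤ.+ toℕ i) ℤ.- ℤ.+ s₀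
    arc-congruence {i} {j} h with arc⇒step {i} {j} h
    ... | inj₁ (s , s∈S , j≡i+s) rewrite j≡i+s =
      subst (ℤ.+ g ℤ∣.∣_) (sym (arc-identityˢ (ℤ.+ toℕ i) (ℤ.+ s) (ℤ.+ s₀) (ℤ.+ t₀)))
        (ℤ∣.∣m∣n⇒∣m-n (∣⇒ℤ∣ (g∣s+t s∈S t₀∈T)) (∣⇒ℤ∣ (g∣s+t s₀∈S t₀∈T)))
    ... | inj₂ (t , t∈T , i≡j+t) rewrite i≡j+t =
      subst (ℤ.+ g ℤ∣.∣_) (sym (arc-identityᵗ (ℤ.+ toℕ j) (ℤ.+ t) (ℤ.+ s₀)))
        (ℤ∣.∣m⇒∣-m (∣⇒ℤ∣ (g∣s+t s₀∈S t∈T)))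

    Walk-congruence : ∀ {ℓ u v} → Walk A ℓ u v →
                      ℤ.+ g ℤ∣.∣ (ℤ.+ toℕ v ℤ.- ℤ.+ toℕ u) ℤ.- ℤ.+ (ℓ * s₀)
    Walk-congruence {zero} {u} refl = ℤ∣.∣ᵤ⇒∣ (subst (g ∣_) (sym (∣[u-u]-x∣≡x (toℕ u) 0)) (g ∣0))
    Walk-congruence {suc ℓ} {u} {v} (w , e , rest) =
      subst (ℤ.+ g ℤ∣.∣_)
            (walk-identity (ℤ.+ toℕ u) (ℤ.+ toℕ w) (ℤ.+ toℕ v) (ℤ.+ s₀) (ℤ.+ (ℓ * s₀)))
        (ℤ∣.∣m∣n⇒∣m+n (arc-congruence {u} {w} e) (Walk-congruence rest))

    closedWalk⇒∣ : ∀ {ℓ u} → Walk A ℓ u u → g ∣ ℓ * s₀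
    closedWalk⇒∣ {ℓ} {u} w =
      subst (g ∣_) (∣[u-u]-x∣≡x (toℕ u) (ℓ * s₀)) (ℤ∣.∣⇒∣ᵤ (Walk-congruence w))

  WalkEnsured⇒loops : (ensured : WalkEnsured n S T) → ∀ {p} → Annihilates g (listMin S) p →
                      ∀ w j → proj₁ ensured ≤ j → Walk A (j * p) w w
  WalkEnsured⇒loops (M , _ , ensured) {p} (p≥1 , g∣ps) w j M≤j =
    ensured w w (j * p) (≤-trans M≤j (m≤m*n j p {{>-nonZero p≥1}}))
      (subst (g ∣_) (sym (∣[u-u]-x∣≡x (toℕ w) (j * p * listMin S)))
        (subst (g ∣_) (sym (*-assoc j p (listMin S))) (∣-trans g∣ps (n∣m*n j))))

  d∣s : ∀ {s} → s ∈ S → d ∣ s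
  d∣s s∈S = gcdList-∣ (∈-++⁺ˡ s∈S)

  d∣t : ∀ {t} → t ∈ T → d ∣ t
  d∣t t∈T = gcdList-∣ (∈-++⁺ʳ S t∈T)

  module _ .{{_ : NonZero d}} where

    private
      +-%-∣ : ∀ x {y} → d ∣ y → (x + y) % d ≡ x % d
      +-%-∣ x (divides q refl) = [m+kn]%n≡m%n x q d

    arc-keepsResidue : ∀ {i j} → A i j ≡ true → toℕ i % d ≡ toℕ j % d
    arc-keepsResidue {i} {j} h with arc⇒step {i} {j} h
    ... | inj₁ (s , s∈S , j≡i+s) rewrite j≡i+s = sym (+-%-∣ (toℕ i) (d∣s s∈S))
    ... | inj₂ (t , t∈T , i≡j+t) rewrite i≡j+t = +-%-∣ (toℕ j) (d∣t t∈T)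

    vertexOfResidue : NonemptySubsetOf n S → ∀ {a} → a < d → ∃ λ (u : Fin n) → toℕ u % d ≡ a
    vertexOfResidue (S≢[] , S⊆[n-1]) {a} a<d =
      fromℕ< a<n , trans (cong (_% d) (toℕ-fromℕ< a<n)) (m<n⇒m%n≡m a<d)
      where
      s∈S : listMin S ∈ S
      s∈S = listMin∈ S≢[]

      d≤s : d ≤ listMin S
      d≤s = ∣⇒≤ {{>-nonZero (proj₁ (lookup S⊆[n-1] s∈S))}} (d∣s s∈S)

      a<n : a < n
      a<n = <-≤-trans a<d (≤-trans d≤s (≤pred⇒≤ (proj₂ (lookup S⊆[n-1] s∈S))))

theorem4p3 : (n : ℕ) (S T : List ℕ) →
    NonemptySubsetOf n S → NonemptySubsetOf n T →
    WalkEnsured n S T →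
    (B : Mat n) → toeplitz n S T ≤ₘ B →
    HasSourceOrSink (B −ₘ toeplitz n S T) (gcdUnion S T) →
    Σ ℕ λ p → MatrixPeriod (toeplitz n S T) p × MatrixPeriod B p
theorem4p3 n S T S-nonempty@(S≢[] , _) (T≢[] , _) ensured B A≤B (a , a<d , sourceOrSink) =
  p , loops⇒MatrixPeriod u p-least loopsA closedA
    , loops⇒MatrixPeriod u p-least (λ w j → Walk-mono A≤B ∘ loopsA w j)
                          (closedA ∘ closedWalk-sourceOrSink arc-keepsResidue sourceOrSink u≡a)
  where
  open ToeplitzWalks {n} S T

  instance
    d≢0 : NonZero d
    d≢0 = >-nonZero (≤-<-trans z≤n a<d)

  p : ℕ
  p = proj₁ (minS-order S-nonempty T≢[])

  p-least : IsLeast (Annihilates g (listMin S)) p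
  p-least = proj₂ (minS-order S-nonempty T≢[])

  u : Fin n
  u = proj₁ (vertexOfResidue S-nonempty a<d)

  u≡a : toℕ u % d ≡ a
  u≡a = proj₂ (vertexOfResidue S-nonempty a<d)

  loopsA : ∀ w j → proj₁ ensured ≤ j → Walk A (j * p) w w
  loopsA = WalkEnsured⇒loops ensured (proj₁ p-least)

  closedA : ∀ {ℓ} → Walk A ℓ u u → g ∣ ℓ * listMin S
  closedA = closedWalk⇒∣ (listMin∈ S≢[]) (listMin∈ T≢[])
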